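{- Let $\Gamma$ be a finite $(G,s)$-geodesic-transitive digraph for some integer $s\geq 2$, where $G\leq\mathrm{Aut}(\Gamma)$, and let $N$ be a nontrivial normal subgroup of $G$. If $N$ has exactly $2$ orbits on $V(\Gamma)$, then $\Gamma$ is $(G,2)$-arc-transitive and bipartite.
   Context: A digraph $\Gamma$ consists of a finite vertex set $V(\Gamma)$ with an antisymmetric irreflexive relation $\rightarrow$; an arc is an ordered pair $(u,v)$ with $u\rightarrow v$. The distance $d_\Gamma(u,v)$ is the length of a shortest directed path from $u$ to $v$. An $s$-arc is a sequence $(v_0,\dots,v_s)$ with $v_i\rightarrow v_{i+1}$ for all $i$; it is an $s$-geodesic if $d_\Gamma(v_0,v_s)=s$. $\Gamma$ is $(G,s)$-geodesic-transitive if $G$ is transitive on the set of $i$-geodesics for each $i\leq s$, and $(G,2)$-arc-transitive if $G$ is transitive on the set of $2$-arcs. Bipartite means $V(\Gamma)$ splits into two parts with every arc joining different parts. -}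

module Defs where

open import Data.Nat using (ℕ; zero; suc; _≤_; _<_)
open import Data.Fin using (Fin)
open import Data.Fin.Permutation using (Permutation′; _⟨$⟩ʳ_; id; flip; _∘ₚ_; _≈_)
open import Data.Bool using (Bool; T)
open import Data.Unit using (⊤)
open import Data.Vec using (Vec; []; _∷_; head; last; map)
open import Data.Product using (Σ; _×_; _,_; ∃)
open import Data.Sum using (_⊎_)
open import Relation.Nullary using (¬_)
open import Relation.Binary.PropositionalEquality using (_≡_; _≢_)

record Digraph (n : ℕ) : Set where
  field
    adj : Fin n → Fin n → Bool
    irrefl : ∀ v → ¬ T (adj v v)
    antisym : ∀ u v → T (adj u v) → ¬ T (adj v u)

  _⇒_ : Fin n → Fin n → Set
  u ⇒ v = T (adj u v)

open Digraph public

module _ {n : ℕ} (Γ : Digraph n) where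

  data Walk : ℕ → Fin n → Fin n → Set where
    here : ∀ {u} → Walk 0 u u
    step : ∀ {k u w v} → _⇒_ Γ u w → Walk k w v → Walk (suc k) u v

  Dist : Fin n → Fin n → ℕ → Set
  Dist u v k = Walk k u v × (∀ j → j < k → ¬ Walk j u v)

  StronglyConnected : Set
  StronglyConnected = ∀ u v → ∃ λ k → Walk k u v

  IsArc : ∀ {k} → Vec (Fin n) (suc k) → Set
  IsArc (v ∷ []) = ⊤
  IsArc (u ∷ v ∷ vs) = _⇒_ Γ u v × IsArc (v ∷ vs)

  IsGeodesic : ∀ k → Vec (Fin n) (suc k) → Set
  IsGeodesic k vs = IsArc vs × Dist (head vs) (last vs) k

  Bipartite : Set
  Bipartite = Σ (Fin n → Bool) λ c → ∀ u v → _⇒_ Γ u v → c u ≢ c v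

  IsAutomorphism : Permutation′ n → Set
  IsAutomorphism g = ∀ u v → (_⇒_ Γ u v → _⇒_ Γ (g ⟨$⟩ʳ u) (g ⟨$⟩ʳ v))
                           × (_⇒_ Γ (g ⟨$⟩ʳ u) (g ⟨$⟩ʳ v) → _⇒_ Γ u v)

record PermGroup (n : ℕ) : Set₁ where
  field
    _∈G : Permutation′ n → Set
    resp : ∀ {g h} → g ≈ h → g ∈G → h ∈G
    id∈ : id ∈G
    comp∈ : ∀ {g h} → g ∈G → h ∈G → (g ∘ₚ h) ∈G
    inv∈ : ∀ {g} → g ∈G → flip g ∈G

open PermGroup public

module _ {n : ℕ} where

  _≤Aut_ : PermGroup n → Digraph n → Set
  G ≤Aut Γ = ∀ g → _∈G G g → IsAutomorphism Γ g

  IsNormalSubgroup : PermGroup n → PermGroup n → Set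
  IsNormalSubgroup N G =
    (∀ h → _∈G N h → _∈G G h) ×
    (∀ g h → _∈G G g → _∈G N h → _∈G N (flip g ∘ₚ (h ∘ₚ g)))

  Nontrivial : PermGroup n → Set
  Nontrivial N = Σ (Permutation′ n) λ h → _∈G N h × Σ (Fin n) λ v → h ⟨$⟩ʳ v ≢ v

  SameOrbit : PermGroup n → Fin n → Fin n → Set
  SameOrbit N u v = Σ (Permutation′ n) λ h → _∈G N h × (h ⟨$⟩ʳ u ≡ v)

  ExactlyTwoOrbits : PermGroup n → Set
  ExactlyTwoOrbits N = Σ (Fin n) λ a → Σ (Fin n) λ b →
    ¬ SameOrbit N a b × (∀ v → SameOrbit N a v ⊎ SameOrbit N b v)

  TransitiveOn : PermGroup n → ∀ {m} → (Vec (Fin n) m → Set) → Set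
  TransitiveOn G P = ∀ x y → P x → P y →
    Σ (Permutation′ n) λ g → _∈G G g × map (g ⟨$⟩ʳ_) x ≡ y

  GeodesicTransitive : Digraph n → PermGroup n → ℕ → Set
  GeodesicTransitive Γ G s = ∀ i → i ≤ s → TransitiveOn G (IsGeodesic Γ i)

  TwoArcTransitive : Digraph n → PermGroup n → Set
  TwoArcTransitive Γ G = TransitiveOn G (IsArc Γ {2})

module Submission where

-- Since G is arc-transitive and preserves the partition into N-orbits, either every arc
-- lies inside an N-orbit or none does. In the first case every directed walk stays inside
-- one orbit, which strong connectivity forbids; so every arc joins the two orbits, and
-- they form a bipartition. In a bipartite digraph both ends of a 2-arc lie in the same
-- part, so they are neither equal (by antisymmetry) nor adjacent: every 2-arc is a
-- 2-geodesic, and 2-geodesic-transitivity is 2-arc-transitivity.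

open import Defs
open import Data.Nat using (ℕ; _≤_; _<_; s≤s; z≤n)
open import Data.Nat.Properties using (≤-trans)
open import Data.Product using (_×_; _,_; proj₂)
open import Data.Sum using (inj₁; inj₂)
open import Data.Fin using (Fin)
open import Data.Fin.Permutation using (_⟨$⟩ʳ_; _⟨$⟩ˡ_; id; flip; _∘ₚ_; inverseˡ)
open import Data.Bool using (Bool; true; false)
open import Data.Bool.Properties using (¬-not)
open import Data.Unit using (tt)
open import Data.Vec using ([]; _∷_)
open import Data.Vec.Properties using (∷-injectiveˡ; ∷-injectiveʳ)
open import Relation.Nullary using (¬_)
open import Relation.Binary.PropositionalEquality
  using (_≡_; _≢_; refl; sym; trans; cong; subst₂)

module _ {n : ℕ} (N : PermGroup n) where

  sameOrbit-refl : ∀ {u} → SameOrbit N u u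
  sameOrbit-refl = id , id∈ N , refl

  sameOrbit-sym : ∀ {u v} → SameOrbit N u v → SameOrbit N v u
  sameOrbit-sym (h , h∈N , hu≡v) =
    flip h , inv∈ N h∈N , trans (cong (h ⟨$⟩ˡ_) (sym hu≡v)) (inverseˡ h)

  sameOrbit-trans : ∀ {u v w} → SameOrbit N u v → SameOrbit N v w → SameOrbit N u w
  sameOrbit-trans (h , h∈N , hu≡v) (k , k∈N , kv≡w) =
    h ∘ₚ k , comp∈ N h∈N k∈N , trans (cong (k ⟨$⟩ʳ_) hu≡v) kv≡w

  sameOrbit-conj : ∀ G → IsNormalSubgroup N G → ∀ g → _∈G G g →
                   ∀ {u v} → SameOrbit N u v → SameOrbit N (g ⟨$⟩ʳ u) (g ⟨$⟩ʳ v)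
  sameOrbit-conj G (_ , normal) g g∈G (h , h∈N , hu≡v) =
    flip g ∘ₚ (h ∘ₚ g) , normal g h g∈G h∈N ,
    cong (g ⟨$⟩ʳ_) (trans (cong (h ⟨$⟩ʳ_) (inverseˡ g)) hu≡v)

  bipartite-twoOrbits : (Γ : Digraph n) → ExactlyTwoOrbits N →
                        (∀ {u v} → _⇒_ Γ u v → ¬ SameOrbit N u v) → Bipartite Γ
  bipartite-twoOrbits Γ (a , b , _ , cover) crossing = colour , λ u v u⇒v cu≡cv →
    crossing u⇒v (sameColour⇒sameOrbit u v cu≡cv)
    where
    colour : Fin n → Bool
    colour v with cover v
    ... | inj₁ _ = true
    ... | inj₂ _ = false

    sameColour⇒sameOrbit : ∀ u v → colour u ≡ colour v → SameOrbit N u v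
    sameColour⇒sameOrbit u v cu≡cv with cover u | cover v
    ... | inj₁ au | inj₁ av = sameOrbit-trans (sameOrbit-sym au) av
    ... | inj₂ bu | inj₂ bv = sameOrbit-trans (sameOrbit-sym bu) bv
    sameColour⇒sameOrbit u v () | inj₁ _ | inj₂ _
    sameColour⇒sameOrbit u v () | inj₂ _ | inj₁ _

module _ {n : ℕ} (Γ : Digraph n) where

  ⇒-irreflexive : ∀ {u v} → _⇒_ Γ u v → u ≢ v
  ⇒-irreflexive {u} u⇒u refl = irrefl Γ u u⇒u

  arc⇒geodesic₁ : ∀ {u v} → _⇒_ Γ u v → IsGeodesic Γ 1 (u ∷ v ∷ [])
  arc⇒geodesic₁ u⇒v = (u⇒v , tt) , step u⇒v here , shorter
    where
    shorter : ∀ j → j < 1 → ¬ Walk Γ j _ _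
    shorter .0 (s≤s z≤n) here = ⇒-irreflexive u⇒v refl

  walk-closure : (_~_ : Fin n → Fin n → Set) → (∀ {u} → u ~ u) →
                 (∀ {u v w} → u ~ v → v ~ w → u ~ w) →
                 (∀ {u v} → _⇒_ Γ u v → u ~ v) → ∀ {k u v} → Walk Γ k u v → u ~ v
  walk-closure _~_ refl~ _ _ here = refl~
  walk-closure _~_ refl~ trans~ arc~ (step u⇒w w→v) =
    trans~ (arc~ u⇒w) (walk-closure _~_ refl~ trans~ arc~ w→v)

  bipartite-2arc⇒geodesic : Bipartite Γ → ∀ x → IsArc Γ {2} x → IsGeodesic Γ 2 x
  bipartite-2arc⇒geodesic (colour , proper) (u ∷ v ∷ w ∷ []) arcs@(u⇒v , v⇒w , tt) =
    arcs , step u⇒v (step v⇒w here) , shorter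
    where
    cu≡cw : colour u ≡ colour w
    cu≡cw = trans (¬-not (proper u v u⇒v))
                  (sym (¬-not (λ cw≡cv → proper v w v⇒w (sym cw≡cv))))

    shorter : ∀ j → j < 2 → ¬ Walk Γ j u w
    shorter .0 (s≤s z≤n) here = antisym Γ u v u⇒v v⇒w
    shorter .1 (s≤s (s≤s z≤n)) (step u⇒w here) = proper u w u⇒w cu≡cw

module _ {n : ℕ} (Γ : Digraph n) (G N : PermGroup n)
         (arcTransitive : TransitiveOn G (IsGeodesic Γ 1)) (normal : IsNormalSubgroup N G) where

  arcInsideOrbit⇒allArcsInsideOrbits : ∀ {u v} → _⇒_ Γ u v → SameOrbit N u v →
                                        ∀ {x y} → _⇒_ Γ x y → SameOrbit N x y
  arcInsideOrbit⇒allArcsInsideOrbits {u} {v} u⇒v u~v {x} {y} x⇒y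
    with arcTransitive (u ∷ v ∷ []) (x ∷ y ∷ []) (arc⇒geodesic₁ Γ u⇒v) (arc⇒geodesic₁ Γ x⇒y)
  ... | g , g∈G , guv≡xy =
    subst₂ (SameOrbit N) (∷-injectiveˡ guv≡xy) (∷-injectiveˡ (∷-injectiveʳ guv≡xy))
           (sameOrbit-conj N G normal g g∈G u~v)

  arcs-cross-orbits : StronglyConnected Γ → ExactlyTwoOrbits N →
                      ∀ {u v} → _⇒_ Γ u v → ¬ SameOrbit N u v
  arcs-cross-orbits connected (a , b , a≁b , _) u⇒v u~v =
    a≁b (walk-closure Γ (SameOrbit N) (sameOrbit-refl N) (sameOrbit-trans N)
                       (arcInsideOrbit⇒allArcsInsideOrbits u⇒v u~v) (proj₂ (connected a b)))

lemma3p2 : (n : ℕ) (Γ : Digraph n) (G N : PermGroup n) (s : ℕ) →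
    StronglyConnected Γ → 2 ≤ s → G ≤Aut Γ → GeodesicTransitive Γ G s →
    IsNormalSubgroup N G → Nontrivial N → ExactlyTwoOrbits N →
    TwoArcTransitive Γ G × Bipartite Γ
lemma3p2 n Γ G N s connected 2≤s _ geodesicTransitive normal _ twoOrbits =
  twoArcTransitive , bipartite
  where
  bipartite : Bipartite Γ
  bipartite = bipartite-twoOrbits N Γ twoOrbits
    (arcs-cross-orbits Γ G N (geodesicTransitive 1 (≤-trans (s≤s z≤n) 2≤s)) normal connected twoOrbits)

  twoArcTransitive : TwoArcTransitive Γ G
  twoArcTransitive x y x-arc y-arc =
    geodesicTransitive 2 2≤s x y (bipartite-2arc⇒geodesic Γ bipartite x x-arc)
                                 (bipartite-2arc⇒geodesic Γ bipartite y y-arc)
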